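{- Let $f=(\alpha_1\alpha_2\cdots\alpha_n)$ be a normalized $n$-player rule. Let $i\neq j$ be indices in $\{1,\dots,n\}$ with $|\alpha_i-\alpha_j|=1$, and let $g$ be the rule obtained from $f$ by swapping the entries $\alpha_i$ and $\alpha_j$. Suppose $$\overline{\mathrm{Mov}}\{P\mid\mathrm{ord}_fP=i-1\}\cap\overline{\mathrm{Mov}}\{P\mid\mathrm{ord}_fP=j-1\}=\varnothing,$$ i.e. no position $R$ has both a chomp move to a position of $f$-ordinal $i-1$ and a chomp move to a position of $f$-ordinal $j-1$. Then $f\sim g$.
   Context: Positions are finite tuples $P=(a_1,\dots,a_k)$ of integers with $a_1\geqslant\dots\geqslant a_k\geqslant0$, where tuples differing only by trailing zeros are identified. $(0)$ is the empty position, $\mathcal{L}$ is the set of positions other than $(0)$, and $|P|=\sum a_i$ is the volume of $P$. A chomp move $P\to Q$ from $P=(a_1,\dots,a_k)$ chooses $1\leqslant x\leqslant k$ and an integer $a\geqslant0$, and sets $Q=(b_1,\dots,b_k)$ with $b_j=a_j$ for $j<x$ and $b_j=\min(a_j,a)$ for $j\geqslant x$, where $Q$ must be a different position from $P$. Write $\mathrm{Mov}P=\{Q:P\to Q\}$. For a set $\mathcal{S}$ of positions, $\overline{\mathrm{Mov}}\mathcal{S}=\{R: R\to Q\text{ for some }Q\in\mathcal{S}\}$. An $n$-player rule is a tuple $f=(\alpha_1\cdots\alpha_n)$ of distinct reals. It is normalized if $(\alpha_1,\dots,\alpha_n)$ is a permutation of $(0,1,\dots,n-1)$. Ordinals $\mathrm{ord}_f$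 are defined recursively on volume as follows. - $\mathrm{ord}_f(0)=0$. - For a position $Q$, set $s_f(Q)=\alpha_{\mathrm{ord}_fQ+1}$ if $\mathrm{ord}_fQ<n$ and $s_f(Q)=\alpha_1$ if $\mathrm{ord}_fQ=n$. - For $P\in\mathcal{L}$, $\mathrm{ord}_fP$ is the unique $i\in\{1,\dots,n\}$ with $\alpha_i=\max_{Q\in\mathrm{Mov}P}s_f(Q)$. Rules $f,g$ are isomorphic, $f\sim g$, if $\mathrm{ord}_fP=\mathrm{ord}_gP$ for all $P\in\mathcal{L}$. -}

module Defs where

open import Data.Nat using (ℕ; zero; suc; _+_; _∸_; _⊓_; _⊔_; _<_; _≥_; _<?_; _≡ᵇ_)
open import Data.Nat.Properties using (_≟_)
open import Data.Fin using (Fin; zero; suc; toℕ; fromℕ<)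
open import Data.Fin.Permutation.Components using (transpose)
open import Data.Nat.ListAction using (sum)
open import Data.List using (List; []; _∷_; map; foldr; length; upTo; concatMap; filter; lookup)
open import Data.List.Properties using (≡-dec)
open import Data.List.Relation.Unary.All using (All)
open import Data.List.Relation.Unary.Linked using (Linked)
open import Data.Bool using (if_then_else_)
open import Data.Product using (Σ; _×_; ∃)
open import Function.Definitions using (Injective)
open import Relation.Binary.PropositionalEquality using (_≡_; _≢_)
open import Relation.Nullary using (¬_; yes; no)

-- Positions: a position (a₁ ≥ … ≥ a_k ≥ 0) modulo trailing zeros is
-- represented canonically by the list with all trailing zeros removed,
-- i.e. a nonincreasing list of positive naturals.  [] is the empty
-- position (0).

Pos : Set
Pos = List ℕ

IsPosition : Pos → Set
IsPosition P = Linked _≥_ P × All (0 <_) P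

vol : Pos → ℕ
vol = sum

trim : List ℕ → List ℕ
trim [] = []
trim (a ∷ l) with trim l
... | [] = if a ≡ᵇ 0 then [] else (a ∷ [])
... | r ∷ rs = a ∷ r ∷ rs

-- chomp with 0-based column x and value a:
-- b_j = a_j for j < x, b_j = min(a_j , a) for j ≥ x
chompAt : ℕ → ℕ → List ℕ → List ℕ
chompAt zero    a l       = map (λ b → b ⊓ a) l
chompAt (suc x) a []      = []
chompAt (suc x) a (b ∷ l) = b ∷ chompAt x a l

-- the chomp move relation P → Q (x ranges over 1..k, here 0..k-1)
Move : Pos → Pos → Set
Move P Q = Σ ℕ λ x → x < length P × Σ ℕ λ a → (Q ≡ trim (chompAt x a P)) × (Q ≢ P)

-- explicit enumeration of Mov P (values a ≥ vol P all yield P itself,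
-- so a ranges over 0 .. vol P - 1; results equal to P are discarded)
movesList : Pos → List Pos
movesList P =
  filter (λ Q → Relation.Nullary.¬? (≡-dec _≟_ Q P))
    (concatMap (λ x → map (λ a → trim (chompAt x a P)) (upTo (vol P)))
               (upTo (length P)))

-- Rules. An n-player rule (α₁ ⋯ αₙ) is a function Fin n → ℕ, where the
-- 0-based index k stands for α_{k+1}.  Normalized: a permutation of
-- (0,…,n-1), i.e. injective with all values < n.

Rule : ℕ → Set
Rule n = Fin n → ℕ

IsNormalized : ∀ {n} → Rule n → Set
IsNormalized {n} α = Injective _≡_ _≡_ α × (∀ k → α k < n)

-- s_f(Q) as a function of o = ord_f Q : α_{o+1} if o < n, α₁ otherwise
sVal : ∀ {n} → Rule n → ℕ → ℕ
sVal {zero}  α o = 0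
sVal {suc m} α o with o <? suc m
... | yes p = α (fromℕ< p)
... | no  _ = α zero

-- the (1-based) index i with α_i = M  (0 if there is none)
findIdx : ∀ {n} → Rule n → ℕ → ℕ
findIdx {zero}  α M = 0
findIdx {suc n} α M with α zero ≡ᵇ M
... | Data.Bool.true  = 1
... | Data.Bool.false with findIdx (λ k → α (suc k)) M
...   | zero  = 0
...   | suc r = suc (suc r)

maxList : List ℕ → ℕ
maxList = foldr _⊔_ 0

-- ord_f computed with fuel (fuel ≥ volume suffices, since moves
-- strictly decrease volume)
ordFuel : ∀ {n} → Rule n → ℕ → Pos → ℕ
ordFuel α zero    P       = 0
ordFuel α (suc k) []      = 0
ordFuel α (suc k) (a ∷ l) =
  findIdx α (maxList (map (λ Q → sVal α (ordFuel α k Q)) (movesList (a ∷ l))))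

ord : ∀ {n} → Rule n → Pos → ℕ
ord α P = ordFuel α (vol P) P

_∼_ : ∀ {n} → Rule n → Rule n → Set
f ∼ g = ∀ P → IsPosition P → P ≢ [] → ord f P ≡ ord g P

swapRule : ∀ {n} → Rule n → Fin n → Fin n → Rule n
swapRule α i j k = α (transpose i j k)

CanMoveToOrd : ∀ {n} → Rule n → ℕ → Pos → Set
CanMoveToOrd f o R = ∃ λ Q → Move R Q × ord f Q ≡ o

-- The ordinal of a position P is read off from the largest value α_{ord Q + 1} over
-- the moves P → Q, taken at the index k₀ attaining it.  Swapping the two
-- adjacent values αᵢ, αⱼ preserves every comparison between indices except the
-- one between i and j themselves; by the separation hypothesis that comparison
-- never occurs among the moves of a single position.  So by induction on the
-- volume the maximum under the swapped rule is attained at the same index k₀,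
-- and both rules assign P the ordinal k₀ + 1.
module Submission where

open import Defs
open import Data.Nat using (ℕ; ∣_-_∣; zero; suc; _+_; _≤_; _<_; _≥_; _⊓_; _<?_; _≡ᵇ_; z≤n; s≤s)
open import Data.Nat.Properties
open import Data.Fin using (Fin; toℕ; fromℕ<) renaming (zero to fzero; suc to fsuc)
import Data.Fin.Properties as Fin
open import Data.Fin.Permutation.Components using (transpose; transpose-inverse)
open import Data.Product using (_×_; ∃; _,_)
open import Data.Sum using (_⊎_; inj₁; inj₂)
open import Data.Bool using (true; false; T)
open import Data.List using (List; []; _∷_; map; length; upTo)
open import Data.List.Relation.Unary.All as All using (All; []; _∷_)
open import Data.List.Relation.Unary.All.Properties using (map⁺)
open import Data.List.Relation.Unary.Any using (here; there)
open import Data.List.Relation.Unary.Linked using (Linked; []; [-]; _∷_)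
open import Data.List.Membership.Propositional using (_∈_; find)
open import Data.List.Membership.Propositional.Properties
open import Data.List.Properties using (map-cong-local; ≡-dec; foldr-preservesᵇ)
open import Function.Definitions using (Injective)
open import Induction.WellFounded using (Acc; acc)
open import Data.Nat.Induction using (<-wellFounded)
open import Relation.Binary.PropositionalEquality using (_≡_; _≢_; refl; sym; trans; cong; subst; module ≡-Reasoning)
open import Relation.Nullary using (¬_; yes; no; ¬?; contradiction)
open import Relation.Nullary.Decidable using (dec-true; dec-false)

trim-∷-head : ∀ b l {r rs} → trim (b ∷ l) ≡ r ∷ rs → r ≡ b
trim-∷-head b l eq with trim l
trim-∷-head zero    l ()   | []
trim-∷-head (suc b) l refl | []    = refl
trim-∷-head b       l refl | _ ∷ _ = refl

trim-isPosition : ∀ l → Linked _≥_ l → IsPosition (trim l)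
trim-isPosition []          _ = [] , []
trim-isPosition (zero ∷ []) _ = [] , []
trim-isPosition (suc a ∷ []) _ = [-] , (s≤s z≤n ∷ [])
trim-isPosition (a ∷ b ∷ l) (b≤a ∷ lk) with trim (b ∷ l) in eq | trim-isPosition (b ∷ l) lk
... | [] | _ with a
...   | zero  = [] , []
...   | suc _ = [-] , (s≤s z≤n ∷ [])
trim-isPosition (a ∷ b ∷ l) (b≤a ∷ lk) | r ∷ rs | lk′ , ps@(0<r ∷ _) =
  r≤a ∷ lk′ , ≤-trans 0<r r≤a ∷ ps
  where r≤a = subst (_≤ a) (sym (trim-∷-head b l eq)) b≤a

vol-trim : ∀ l → vol (trim l) ≡ vol l
vol-trim [] = refl
vol-trim (a ∷ l) with trim l | vol-trim l
... | [] | e with a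
...   | zero  = e
...   | suc a′ = cong (suc a′ +_) e
vol-trim (a ∷ l) | _ ∷ _ | e = cong (a +_) e

trim-positive : ∀ l → All (0 <_) l → trim l ≡ l
trim-positive [] _ = refl
trim-positive (a ∷ l) (_ ∷ ps) with trim l | trim-positive l ps
trim-positive (suc a ∷ .[]) _ | [] | refl = refl
... | _ ∷ _ | refl = refl

trim-chompAll : ∀ l → trim (chompAt 0 0 l) ≡ []
trim-chompAll [] = refl
trim-chompAll (b ∷ l) rewrite trim-chompAll l | ⊓-zeroʳ b = refl

∷-≡-or-vol< : ∀ {b b′ l l′} → b′ ≡ b ⊎ b′ < b → l′ ≡ l ⊎ vol l′ < vol l →
              b′ ∷ l′ ≡ b ∷ l ⊎ vol (b′ ∷ l′) < vol (b ∷ l)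
∷-≡-or-vol< (inj₁ refl) (inj₁ refl) = inj₁ refl
∷-≡-or-vol< (inj₁ refl) (inj₂ lt)   = inj₂ (+-monoʳ-< _ lt)
∷-≡-or-vol< (inj₂ lt)   (inj₁ refl) = inj₂ (+-monoˡ-< _ lt)
∷-≡-or-vol< (inj₂ lt)   (inj₂ lt′)  = inj₂ (+-mono-< lt lt′)

⊓-≡-or-< : ∀ b a → b ⊓ a ≡ b ⊎ b ⊓ a < b
⊓-≡-or-< b a with b ⊓ a ≟ b
... | yes e  = inj₁ e
... | no  ne = inj₂ (≤∧≢⇒< (m⊓n≤m b a) ne)

chompAt-≡-or-vol< : ∀ x a l → chompAt x a l ≡ l ⊎ vol (chompAt x a l) < vol l
chompAt-≡-or-vol< x       a []      = inj₁ (chompAt-[] x)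
  where
  chompAt-[] : ∀ x → chompAt x a [] ≡ []
  chompAt-[] zero    = refl
  chompAt-[] (suc _) = refl
chompAt-≡-or-vol< zero    a (b ∷ l) = ∷-≡-or-vol< (⊓-≡-or-< b a) (chompAt-≡-or-vol< zero a l)
chompAt-≡-or-vol< (suc x) a (b ∷ l) = ∷-≡-or-vol< (inj₁ refl) (chompAt-≡-or-vol< x a l)

chompAt-linked : ∀ x a l → Linked _≥_ l → Linked _≥_ (chompAt x a l)
chompAt-linked zero    a []          _          = []
chompAt-linked zero    a (b ∷ [])    _          = [-]
chompAt-linked zero    a (b ∷ c ∷ l) (c≤b ∷ lk) = ⊓-monoˡ-≤ a c≤b ∷ chompAt-linked zero a (c ∷ l) lk
chompAt-linked (suc x) a []          _          = []
chompAt-linked (suc zero)    a (b ∷ []) _ = [-]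
chompAt-linked (suc (suc x)) a (b ∷ []) _ = [-]
chompAt-linked (suc zero)    a (b ∷ c ∷ l) (c≤b ∷ lk) =
  ≤-trans (m⊓n≤m c a) c≤b ∷ chompAt-linked zero a (c ∷ l) lk
chompAt-linked (suc (suc x)) a (b ∷ c ∷ l) (c≤b ∷ lk) = c≤b ∷ chompAt-linked (suc x) a (c ∷ l) lk

Move-isPosition : ∀ {P Q} → IsPosition P → Move P Q → IsPosition Q
Move-isPosition {P} (lk , _) (x , _ , a , refl , _) = trim-isPosition _ (chompAt-linked x a P lk)

Move-vol< : ∀ {P Q} → IsPosition P → Move P Q → vol Q < vol P
Move-vol< {P} (_ , ps) (x , _ , a , refl , Q≢P) with chompAt-≡-or-vol< x a P
... | inj₁ e  = contradiction (trans (cong trim e) (trim-positive P ps)) Q≢P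
... | inj₂ lt = subst (_< vol P) (sym (vol-trim (chompAt x a P))) lt

chompsAt : Pos → ℕ → List Pos
chompsAt P x = map (λ a → trim (chompAt x a P)) (upTo (vol P))

∈-movesList⇒Move : ∀ {P Q} → Q ∈ movesList P → Move P Q
∈-movesList⇒Move {P} q with ∈-filter⁻ (λ Q → ¬? (≡-dec _≟_ Q P)) q
... | q′ , Q≢P with find (∈-concatMap⁻ (chompsAt P) {xs = upTo (length P)} q′)
... | x , x∈ , q″ with ∈-map⁻ (λ a → trim (chompAt x a P)) q″
... | a , _ , Q≡ = x , ∈-upTo⁻ x∈ , a , Q≡ , Q≢P

[]∈movesList : ∀ {a l} → IsPosition (a ∷ l) → [] ∈ movesList (a ∷ l)
[]∈movesList {zero}      (_ , () ∷ _)
[]∈movesList {suc a} {l} _ =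
  ∈-filter⁺ (λ Q → ¬? (≡-dec _≟_ Q P))
    (∈-concatMap⁺ (chompsAt P) {xs = upTo (length P)}
      (here (subst (_∈ chompsAt P 0) (trim-chompAll P) (∈-map⁺ (λ a′ → trim (chompAt 0 a′ P)) (here refl)))))
    (λ ())
  where P = suc a ∷ l

≤-maxList : ∀ {x xs} → x ∈ xs → x ≤ maxList xs
≤-maxList (here refl) = m≤m⊔n _ _
≤-maxList (there x∈)  = m≤n⇒m≤o⊔n _ (≤-maxList x∈)

maxList-∈ : ∀ {x xs} → x ∈ xs → maxList xs ∈ xs
maxList-∈ {x} {xs} x∈ with foldr-selective ⊔-sel 0 xs
... | inj₂ max∈ = max∈
... | inj₁ max≡0 = subst (_∈ xs) (trans (n≤0⇒n≡0 (subst (x ≤_) max≡0 (≤-maxList x∈))) (sym max≡0)) x∈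

maxList-≡ : ∀ {v xs} → v ∈ xs → All (_≤ v) xs → maxList xs ≡ v
maxList-≡ v∈ xs≤v = ≤-antisym (foldr-preservesᵇ ⊔-lub z≤n xs≤v) (≤-maxList v∈)

findIdx-injective : ∀ {n} (α : Rule n) → Injective _≡_ _≡_ α → ∀ k → findIdx α (α k) ≡ suc (toℕ k)
findIdx-injective {suc n} α α-inj k with α fzero ≡ᵇ α k in eq
... | true with α-inj (≡ᵇ⇒≡ _ _ (subst T (sym eq) _))
...   | refl = refl
findIdx-injective {suc n} α α-inj fzero    | false = contradiction (≡⇒≡ᵇ (α fzero) _ refl) (subst T eq)
findIdx-injective {suc n} α α-inj (fsuc k) | false
  rewrite findIdx-injective (λ k → α (fsuc k)) (λ e → Fin.suc-injective (α-inj e)) k = refl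

-- An ordinal o ∈ {0, …, n} reduced modulo n, as an index into the rule.
sIndex : ∀ {m} → ℕ → Fin (suc m)
sIndex {m} o with o <? suc m
... | yes o<n = fromℕ< o<n
... | no  _   = fzero

sVal-sIndex : ∀ {m} (α : Rule (suc m)) o → sVal α o ≡ α (sIndex o)
sVal-sIndex {m} α o with o <? suc m
... | yes _ = refl
... | no  _ = refl

sIndex-zero-or-toℕ : ∀ {m} o → sIndex {m} o ≡ fzero ⊎ o ≡ toℕ (sIndex {m} o)
sIndex-zero-or-toℕ {m} o with o <? suc m
... | yes o<n = inj₂ (sym (Fin.toℕ-fromℕ< o<n))
... | no  _   = inj₁ refl

ordFuel-[] : ∀ {n} (α : Rule n) k → ordFuel α k [] ≡ 0
ordFuel-[] α zero    = refl
ordFuel-[] α (suc k) = refl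

ordFuel-fuel : ∀ {n} (α : Rule n) k k′ P → IsPosition P → vol P ≤ k → vol P ≤ k′ →
               ordFuel α k P ≡ ordFuel α k′ P
ordFuel-fuel α k k′ [] _ _ _ = trans (ordFuel-[] α k) (sym (ordFuel-[] α k′))
ordFuel-fuel α k k′ (zero ∷ l) (_ , () ∷ _) _ _
ordFuel-fuel α (suc k) (suc k′) (suc a ∷ l) pos P≤k P≤k′ =
  cong (findIdx α) (cong maxList (map-cong-local (All.tabulate sameOrd)))
  where
  sameOrd : ∀ {Q} → Q ∈ movesList (suc a ∷ l) → sVal α (ordFuel α k Q) ≡ sVal α (ordFuel α k′ Q)
  sameOrd q = cong (sVal α) (ordFuel-fuel α k k′ _ (Move-isPosition pos mv)
                               (≤-pred (≤-trans (Move-vol< pos mv) P≤k))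
                               (≤-pred (≤-trans (Move-vol< pos mv) P≤k′)))
    where mv = ∈-movesList⇒Move q

sValue : ∀ {m} → Rule (suc m) → Pos → ℕ
sValue α Q = α (sIndex (ord α Q))

ord-unfold : ∀ {m} (α : Rule (suc m)) {a l} → IsPosition (a ∷ l) →
             ord α (a ∷ l) ≡ findIdx α (maxList (map (sValue α) (movesList (a ∷ l))))
ord-unfold α {zero}      (_ , () ∷ _)
ord-unfold α {suc a} {l} pos =
  cong (findIdx α) (cong maxList (map-cong-local (All.tabulate enoughFuel)))
  where
  enoughFuel : ∀ {Q} → Q ∈ movesList (suc a ∷ l) → sVal α (ordFuel α (a + vol l) Q) ≡ sValue α Q
  enoughFuel {Q} q = trans (cong (sVal α) (ordFuel-fuel α _ _ _ (Move-isPosition pos mv)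
                                             (≤-pred (Move-vol< pos mv)) ≤-refl))
                           (sVal-sIndex α (ord α Q))
    where mv = ∈-movesList⇒Move q

sValue-maximizer : ∀ {m} (α : Rule (suc m)) {a l} → IsPosition (a ∷ l) →
                   ∃ λ Q₀ → Q₀ ∈ movesList (a ∷ l) × ∀ {Q} → Q ∈ movesList (a ∷ l) → sValue α Q ≤ sValue α Q₀
sValue-maximizer α pos with ∈-map⁻ (sValue α) (maxList-∈ (∈-map⁺ (sValue α) ([]∈movesList pos)))
... | Q₀ , q₀ , max≡ = Q₀ , q₀ , λ q → subst (_ ≤_) max≡ (≤-maxList (∈-map⁺ (sValue α) q))

ord-≡-maximizer : ∀ {m} (α : Rule (suc m)) → Injective _≡_ _≡_ α → ∀ {a l Q₀} k →
                  IsPosition (a ∷ l) → Q₀ ∈ movesList (a ∷ l) → sIndex (ord α Q₀) ≡ k →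
                  (∀ {Q} → Q ∈ movesList (a ∷ l) → sValue α Q ≤ α k) →
                  ord α (a ∷ l) ≡ suc (toℕ k)
ord-≡-maximizer α α-injective {a} {l} k pos q₀ refl ≤αk = begin
  ord α (a ∷ l)                                            ≡⟨ ord-unfold α pos ⟩
  findIdx α (maxList (map (sValue α) (movesList (a ∷ l)))) ≡⟨ cong (findIdx α) max≡αk ⟩
  findIdx α (α k)                                          ≡⟨ findIdx-injective α α-injective k ⟩
  suc (toℕ k)                                              ∎
  where
  open ≡-Reasoning
  max≡αk = maxList-≡ (∈-map⁺ (sValue α) q₀) (map⁺ (All.tabulate ≤αk))

canMoveToOrd-sIndex : ∀ {m} (α : Rule (suc m)) {a l Q} (t : Fin (suc m)) → IsPosition (a ∷ l) →
                      Q ∈ movesList (a ∷ l) → sIndex (ord α Q) ≡ t → CanMoveToOrd α (toℕ t) (a ∷ l)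
canMoveToOrd-sIndex α {Q = Q} _ pos q refl with sIndex-zero-or-toℕ (ord α Q)
... | inj₁ index≡0 = [] , ∈-movesList⇒Move ([]∈movesList pos) , cong toℕ (sym index≡0)
... | inj₂ ord≡    = Q , ∈-movesList⇒Move q , ord≡

∣m-n∣≡1⇒m≤1+n : ∀ {m n} → ∣ m - n ∣ ≡ 1 → m ≤ suc n
∣m-n∣≡1⇒m≤1+n {zero}              _    = z≤n
∣m-n∣≡1⇒m≤1+n {suc zero} {zero}   refl = ≤-refl
∣m-n∣≡1⇒m≤1+n {suc m}    {suc n}  e    = s≤s (∣m-n∣≡1⇒m≤1+n e)

data Transposed {n} (i j : Fin n) : Fin n → Fin n → Set where
  left  : Transposed i j i j
  right : Transposed i j j i
  fixed : ∀ {k} → k ≢ i → k ≢ j → Transposed i j k k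

transpose-view : ∀ {n} (i j k : Fin n) → Transposed i j k (transpose i j k)
transpose-view i j k with k Fin.≟ i | k Fin.≟ j
... | yes refl | _        = left
... | no _     | yes refl rewrite dec-true (j Fin.≟ j) refl = right
... | no k≢i   | no k≢j   rewrite dec-false (k Fin.≟ j) k≢j = fixed k≢i k≢j

module _ {n} (f : Rule n) (f-injective : Injective _≡_ _≡_ f) where

  private
    partner-≤ : ∀ {a b y} → f b ≤ suc (f a) → y ≢ a → f a ≤ f y → f b ≤ f y
    partner-≤ b≤a+1 y≢a a≤y = ≤-trans b≤a+1 (≤∧≢⇒< a≤y (λ e → y≢a (sym (f-injective e))))

    ≤-partner : ∀ {a b x} → f a ≤ suc (f b) → x ≢ a → f x ≤ f a → f x ≤ f b
    ≤-partner a≤b+1 x≢a x≤a = ≤-pred (≤-trans (≤∧≢⇒< x≤a (λ e → x≢a (f-injective e))) a≤b+1)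

  swapRule-mono : ∀ {i j} → ∣ f i - f j ∣ ≡ 1 → ∀ x y →
                  ¬ (x ≡ i × y ≡ j) → ¬ (x ≡ j × y ≡ i) →
                  f x ≤ f y → swapRule f i j x ≤ swapRule f i j y
  swapRule-mono {i} {j} adj x y = go (transpose-view i j x) (transpose-view i j y)
    where
    i≤j+1 = ∣m-n∣≡1⇒m≤1+n adj
    j≤i+1 = ∣m-n∣≡1⇒m≤1+n (trans (∣-∣-comm (f j) (f i)) adj)

    go : ∀ {x x′ y y′} → Transposed i j x x′ → Transposed i j y y′ →
         ¬ (x ≡ i × y ≡ j) → ¬ (x ≡ j × y ≡ i) → f x ≤ f y → f x′ ≤ f y′
    go left        left        _   _   _ = ≤-refl
    go left        right       ¬ij _   _ = contradiction (refl , refl) ¬ij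
    go left        (fixed y≢i _) _ _   le = partner-≤ j≤i+1 y≢i le
    go right       left        _   ¬ji _ = contradiction (refl , refl) ¬ji
    go right       right       _   _   _ = ≤-refl
    go right       (fixed _ y≢j) _ _   le = partner-≤ i≤j+1 y≢j le
    go (fixed x≢i _) left      _   _   le = ≤-partner i≤j+1 x≢i le
    go (fixed _ x≢j) right     _   _   le = ≤-partner j≤i+1 x≢j le
    go (fixed _ _) (fixed _ _) _   _   le = le

  swapRule-injective : ∀ i j → Injective _≡_ _≡_ (swapRule f i j)
  swapRule-injective i j e =
    trans (sym (transpose-inverse j i)) (trans (cong (transpose j i) (f-injective e)) (transpose-inverse j i))

module _ {m} (f : Rule (suc m)) (f-injective : Injective _≡_ _≡_ f) {i j : Fin (suc m)}
         (adjacent : ∣ f i - f j ∣ ≡ 1)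
         (separated : ¬ (∃ λ R → IsPosition R × CanMoveToOrd f (toℕ i) R × CanMoveToOrd f (toℕ j) R))
         where

  ord-swapRule-acc : ∀ P → Acc _<_ (vol P) → IsPosition P → ord f P ≡ ord (swapRule f i j) P
  ord-swapRule-acc []      _        _   = refl
  ord-swapRule-acc (a ∷ l) (acc rs) pos with sValue-maximizer f pos
  ... | Q₀ , q₀ , Q₀-max =
    trans (ord-≡-maximizer f f-injective k₀ pos q₀ refl Q₀-max)
          (sym (ord-≡-maximizer g (swapRule-injective f f-injective i j) k₀ pos q₀
                                (cong sIndex (sym (ih q₀))) g≤gk₀))
    where
    g = swapRule f i j
    k₀ = sIndex (ord f Q₀)

    ih : ∀ {Q} → Q ∈ movesList (a ∷ l) → ord f Q ≡ ord g Q
    ih q = ord-swapRule-acc _ (rs (Move-vol< pos mv)) (Move-isPosition pos mv)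
      where mv = ∈-movesList⇒Move q

    g≤gk₀ : ∀ {Q} → Q ∈ movesList (a ∷ l) → sValue g Q ≤ g k₀
    g≤gk₀ {Q} q = subst (λ o → g (sIndex o) ≤ g k₀) (ih q)
      (swapRule-mono f f-injective adjacent (sIndex (ord f Q)) k₀
        (λ (Q↦i , Q₀↦j) → separated (_ , pos , canMoveToOrd-sIndex f i pos q Q↦i
                                            , canMoveToOrd-sIndex f j pos q₀ Q₀↦j))
        (λ (Q↦j , Q₀↦i) → separated (_ , pos , canMoveToOrd-sIndex f i pos q₀ Q₀↦i
                                            , canMoveToOrd-sIndex f j pos q Q↦j))
        (Q₀-max q))

  ord-swapRule : ∀ P → IsPosition P → ord f P ≡ ord (swapRule f i j) P
  ord-swapRule P = ord-swapRule-acc P (<-wellFounded (vol P))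

theorem4p1 : ∀ {n} (f : Rule n) → IsNormalized f → (i j : Fin n) → i ≢ j →
             ∣ f i - f j ∣ ≡ 1 →
             ¬ (∃ λ R → IsPosition R × CanMoveToOrd f (toℕ i) R × CanMoveToOrd f (toℕ j) R) →
             f ∼ swapRule f i j
theorem4p1 {suc m} f (f-injective , _) i j _ adjacent separated P pos _ =
  ord-swapRule f f-injective adjacent separated P pos
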